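{- Let $G=([m]\cup[n],E)$ be a domination graph, $w\ge 0$, and consider the compatibility graph defined by $G$. For every d-closed set $V\subseteq\{0,1\}^m$, we have $|N(V)|=\Psi(V)$.
   Context: $\mathcal{B}(n,w)$ is the set of binary words of length $n$ with at most $w$ ones. A domination graph is a bipartite graph $G=([m]\cup[n],E)$ with left vertex set $[m]$ and right vertex set $[n]$ having no isolated right vertices. The compatibility graph defined by $G$ is the bipartite graph on $\{0,1\}^m\cup\mathcal{B}(n,w)$ in which $x\in\{0,1\}^m$ is adjacent to $y\in\mathcal{B}(n,w)$ iff for every $(i,j)\in E$, $x_i=0$ implies $y_j=0$. For $X\subseteq\{0,1\}^m$, $N(X)$ is the set of vertices of $\mathcal{B}(n,w)$ adjacent to some element of $X$, and $N(v)=N(\{v\})$. For $u,v\in\{0,1\}^m$, write $v\prec u$ if $\mathrm{supp}(v)\subseteq\mathrm{supp}(u)$; $v$ is a proper descendant of $u$ if $v\prec u$ and $v\ne u$. $V$ is d-closed if $u\in V$ and $v\prec u$ imply $v\in V$. For $v\in\{0,1\}^m$, $\Psi(v)$ is the number of $y\in N(v)$ such that $y\notin N(v')$ for every proper descendant $v'$ of $v$; for $V\subseteq\{0,1\}^m$, $\Psi(V)=\sum_{v\in V}\Psi(v)$. -}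

module Defs where

open import Data.Bool using (Bool; true; false; _∧_; _∨_; not; if_then_else_; T)
open import Data.Bool.Properties using () renaming (_≟_ to _≟ᵇ_)
open import Data.Nat using (ℕ; zero; suc; _+_; _≤ᵇ_)
open import Data.Fin using (Fin)
open import Data.Vec using (Vec; []; _∷_; lookup)
open import Data.Vec.Properties using (≡-dec)
open import Data.List using (List; []; _∷_; map; _++_; length; filterᵇ; allFin)
open import Data.Bool.ListAction using (all; any)
open import Data.Nat.ListAction using (sum)
open import Data.Product using (∃)
open import Relation.Binary.PropositionalEquality using (_≡_)
open import Relation.Nullary.Decidable using (⌊_⌋)

-- {0,1}^k : binary words of length k (true = 1, false = 0)
Word : ℕ → Set
Word k = Vec Bool k

allWords : (k : ℕ) → List (Word k)
allWords zero = [] ∷ []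
allWords (suc k) = map (false ∷_) (allWords k) ++ map (true ∷_) (allWords k)

weight : ∀ {k} → Word k → ℕ
weight [] = 0
weight (true ∷ y) = suc (weight y)
weight (false ∷ y) = weight y

B : (n w : ℕ) → List (Word n)
B n w = filterᵇ (λ y → weight y ≤ᵇ w) (allWords n)

-- Bipartite graph on left [m] and right [n], given by its edge indicator:
-- E i j ≡ true  iff  (i , j) ∈ E.
Edges : ℕ → ℕ → Set
Edges m n = Fin m → Fin n → Bool

IsDominationGraph : ∀ {m n} → Edges m n → Set
IsDominationGraph {m} {n} E = (j : Fin n) → ∃ λ (i : Fin m) → E i j ≡ true

-- compatibility: x ~ y iff for every (i,j) ∈ E, x_i = 0 implies y_j = 0
compat : ∀ {m n} → Edges m n → Word m → Word n → Bool
compat {m} {n} E x y =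
  all (λ i → all (λ j → not (E i j ∧ not (lookup x i)) ∨ not (lookup y j)) (allFin n)) (allFin m)

_≺_ : ∀ {m} → Word m → Word m → Set
_≺_ {m} v u = (i : Fin m) → lookup v i ≡ true → lookup u i ≡ true

descᵇ : ∀ {m} → Word m → Word m → Bool
descᵇ {m} v u = all (λ i → not (lookup v i) ∨ lookup u i) (allFin m)

properDescᵇ : ∀ {m} → Word m → Word m → Bool
properDescᵇ v' v = descᵇ v' v ∧ not ⌊ ≡-dec _≟ᵇ_ v' v ⌋

-- subsets of {0,1}^m as decidable predicates
Subset : ℕ → Set
Subset m = Word m → Bool

DClosed : ∀ {m} → Subset m → Set
DClosed {m} V = (u v : Word m) → V u ≡ true → v ≺ u → V v ≡ true

|N| : ∀ {m n} → Edges m n → ℕ → Subset m → ℕ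
|N| {m} {n} E w V =
  length (filterᵇ (λ y → any (λ x → V x ∧ compat E x y) (allWords m)) (B n w))

Ψ : ∀ {m n} → Edges m n → ℕ → Word m → ℕ
Ψ {m} {n} E w v =
  length (filterᵇ (λ y → compat E v y ∧
                         all (λ v' → not (properDescᵇ v' v ∧ compat E v' y)) (allWords m))
                  (B n w))

ΨSet : ∀ {m n} → Edges m n → ℕ → Subset m → ℕ
ΨSet {m} E w V = sum (map (λ v → if V v then Ψ E w v else 0) (allWords m))

module Submission where

-- Every y ∈ B(n,w) has a least compatible word μ y ∈ {0,1}^m:
-- (μ y)_i = 1 iff some edge (i,j) has y_j = 1.  A word x is compatible
-- with y exactly when μ y ≺ x.  Consequently
--   (1) for d-closed V, y ∈ N(V) iff μ y ∈ V, and
--   (2) y is counted by Ψ(v) iff v = μ y, since μ y is compatible with y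
--       and is the only compatible word without a compatible proper
--       descendant.
-- So Ψ(V) counts each y with μ y ∈ V exactly once, namely in the summand
-- v = μ y, and these y are exactly N(V).

open import Defs
open import Data.Nat using (ℕ; zero; suc; _+_)
open import Data.Nat.Properties using (+-identityʳ; +-commutativeSemigroup)
open import Algebra.Properties.CommutativeSemigroup +-commutativeSemigroup using (interchange)
open import Data.Bool using (Bool; true; false; _∧_; _∨_; not; if_then_else_)
open import Data.Bool.Properties using (T-≡; ⇔→≡; ¬-not; not-¬; ∧-identityʳ) renaming (_≟_ to _≟ᵇ_)
open import Data.Fin using (Fin)
open import Data.Vec using (_∷_; []; lookup; tabulate)
open import Data.Vec.Properties
  using (≡-dec; ∷-injectiveˡ; ∷-injectiveʳ; lookup∘tabulate; tabulate∘lookup; tabulate-cong)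
open import Data.List using (List; []; _∷_; map; _++_; length; filterᵇ; allFin)
open import Data.List.Properties using (map-++; map-∘; map-cong)
open import Data.Bool.ListAction using (all; any)
open import Data.Nat.ListAction using (sum)
open import Data.Nat.ListAction.Properties using (sum-++)
open import Data.List.Membership.Propositional using (_∈_; find; lose)
open import Data.List.Membership.Propositional.Properties using (∈-allFin; ∈-++⁺ˡ; ∈-++⁺ʳ; ∈-map⁺)
import Data.List.Relation.Unary.All as All
open import Data.List.Relation.Unary.Any using (here)
open import Data.List.Relation.Unary.All.Properties using (all⁺; all⁻)
open import Data.List.Relation.Unary.Any.Properties using (any⁺; any⁻)
open import Data.Product using (∃; _×_; _,_; proj₂)
open import Data.Empty using (⊥-elim)
open import Function using (_∘_; _⇔_; mk⇔; Equivalence)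
open import Relation.Nullary using (yes; no; ¬_)
open import Relation.Nullary.Decidable using (⌊_⌋)
open import Relation.Binary.PropositionalEquality
  using (_≡_; _≢_; refl; sym; trans; cong; cong₂; module ≡-Reasoning)

open Equivalence using (to; from)
open ≡-Reasoning

module _ {A : Set} (p : A → Bool) where

  all-true⇒ : ∀ {xs} → all p xs ≡ true → ∀ {x} → x ∈ xs → p x ≡ true
  all-true⇒ {xs} h x∈xs = to T-≡ (All.lookup (all⁺ p xs (from T-≡ h)) x∈xs)

  all-true⇐ : ∀ {xs} → (∀ {x} → x ∈ xs → p x ≡ true) → all p xs ≡ true
  all-true⇐ h = to T-≡ (all⁻ p (All.tabulate (λ x∈xs → from T-≡ (h x∈xs))))

  any-true⇒ : ∀ xs → any p xs ≡ true → ∃ λ x → x ∈ xs × p x ≡ true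
  any-true⇒ xs h with find (any⁻ p xs (from T-≡ h))
  ... | x , x∈xs , px = x , x∈xs , to T-≡ px

  any-true⇐ : ∀ {xs x} → x ∈ xs → p x ≡ true → any p xs ≡ true
  any-true⇐ x∈xs px = to T-≡ (any⁺ p (lose x∈xs (from T-≡ px)))

∧-true : ∀ {a b} → a ∧ b ≡ true ⇔ (a ≡ true × b ≡ true)
∧-true {true} = mk⇔ (λ b → refl , b) (λ (_ , b) → b)
∧-true {false} = mk⇔ (λ ()) (λ ())

∈-allWords : ∀ {k} (v : Word k) → v ∈ allWords k
∈-allWords [] = here refl
∈-allWords (false ∷ v) = ∈-++⁺ˡ (∈-map⁺ (false ∷_) (∈-allWords v))
∈-allWords (true ∷ v) = ∈-++⁺ʳ _ (∈-map⁺ (true ∷_) (∈-allWords v))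

ι : Bool → ℕ
ι b = if b then 1 else 0

sum-map-++ : ∀ {A : Set} (g : A → ℕ) xs ys → sum (map g (xs ++ ys)) ≡ sum (map g xs) + sum (map g ys)
sum-map-++ g xs ys = trans (cong sum (map-++ g xs ys)) (sum-++ (map g xs) (map g ys))

sum-map-+ : ∀ {A : Set} (g h : A → ℕ) xs → sum (map (λ x → g x + h x) xs) ≡ sum (map g xs) + sum (map h xs)
sum-map-+ g h [] = refl
sum-map-+ g h (x ∷ xs) = trans (cong (g x + h x +_) (sum-map-+ g h xs))
                               (interchange (g x) (h x) (sum (map g xs)) (sum (map h xs)))

allWords-point : ∀ k (q : Word k → Bool) (a : Word k) → (∀ v → q v ≡ true → v ≡ a) →
                 sum (map (ι ∘ q) (allWords k)) ≡ ι (q a)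
allWords-point zero q [] _ = +-identityʳ _
allWords-point (suc k) q (c ∷ a) only-a = begin
  sum (map (ι ∘ q) (map (false ∷_) W ++ map (true ∷_) W))
    ≡⟨ sum-map-++ (ι ∘ q) (map (false ∷_) W) (map (true ∷_) W) ⟩
  sum (map (ι ∘ q) (map (false ∷_) W)) + sum (map (ι ∘ q) (map (true ∷_) W))
    ≡⟨ cong₂ _+_ (half false) (half true) ⟩
  ι (q (false ∷ a)) + ι (q (true ∷ a))
    ≡⟨ at-head c other-half-empty ⟩
  ι (q (c ∷ a)) ∎
  where
  W : List (Word k)
  W = allWords k

  half : ∀ b → sum (map (ι ∘ q) (map (b ∷_) W)) ≡ ι (q (b ∷ a))
  half b = trans (cong sum (sym (map-∘ W)))
                 (allWords-point k (q ∘ (b ∷_)) a (λ v qbv → ∷-injectiveʳ (only-a _ qbv)))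

  other-half-empty : q (not c ∷ a) ≡ false
  other-half-empty = ¬-not (λ q-true → not-¬ refl (sym (∷-injectiveˡ (only-a _ q-true))))

  at-head : ∀ d → q (not d ∷ a) ≡ false → ι (q (false ∷ a)) + ι (q (true ∷ a)) ≡ ι (q (d ∷ a))
  at-head false q-false = trans (cong (λ b → ι (q (false ∷ a)) + ι b) q-false) (+-identityʳ _)
  at-head true q-false = cong (λ b → ι b + ι (q (true ∷ a))) q-false

length-filterᵇ-∷ : ∀ {A : Set} (p : A → Bool) x xs →
                   length (filterᵇ p (x ∷ xs)) ≡ ι (p x) + length (filterᵇ p xs)
length-filterᵇ-∷ p x xs with p x
... | true = refl
... | false = refl

filterᵇ-cong : ∀ {A : Set} {p q : A → Bool} → (∀ x → p x ≡ q x) → ∀ xs → filterᵇ p xs ≡ filterᵇ q xs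
filterᵇ-cong p≗q [] = refl
filterᵇ-cong {p = p} {q} p≗q (x ∷ xs) with p x | q x | p≗q x
... | true | true | refl = cong (x ∷_) (filterᵇ-cong p≗q xs)
... | false | false | refl = filterᵇ-cong p≗q xs

ΣV : ∀ {m} → Subset m → (Word m → ℕ) → ℕ
ΣV {m} V g = sum (map (λ v → if V v then g v else 0) (allWords m))

ΣV-cong : ∀ {m} (V : Subset m) {g h : Word m → ℕ} → (∀ v → g v ≡ h v) → ΣV V g ≡ ΣV V h
ΣV-cong {m} V g≗h = cong sum (map-cong (λ v → cong (λ k → if V v then k else 0) (g≗h v)) (allWords m))

ΣV-0 : ∀ {m} (V : Subset m) → ΣV V (λ _ → 0) ≡ 0
ΣV-0 {m} V = zeros (allWords m)
  where
  zeros : ∀ vs → sum (map (λ v → if V v then 0 else 0) vs) ≡ 0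
  zeros [] = refl
  zeros (v ∷ vs) with V v
  ... | true = zeros vs
  ... | false = zeros vs

ΣV-+ : ∀ {m} (V : Subset m) (g h : Word m → ℕ) → ΣV V (λ v → g v + h v) ≡ ΣV V g + ΣV V h
ΣV-+ {m} V g h = trans (cong sum (map-cong split (allWords m))) (sum-map-+ _ _ (allWords m))
  where
  split : ∀ v → (if V v then g v + h v else 0) ≡ (if V v then g v else 0) + (if V v then h v else 0)
  split v with V v
  ... | true = refl
  ... | false = refl

ΣV-point : ∀ {m} (V : Subset m) (q : Word m → Bool) (a : Word m) → (∀ v → q v ≡ true → v ≡ a) →
           ΣV V (ι ∘ q) ≡ ι (V a ∧ q a)
ΣV-point {m} V q a only-a = trans (cong sum (map-cong restrict (allWords m)))
  (allWords-point m (λ v → V v ∧ q v) a (λ v Vq → only-a v (proj₂ (to ∧-true Vq))))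
  where
  restrict : ∀ v → (if V v then ι (q v) else 0) ≡ ι (V v ∧ q v)
  restrict v with V v
  ... | true = refl
  ... | false = refl

fibre-count : ∀ {m} {A : Set} (V : Subset m) (f : A → Word m) (R : Word m → A → Bool) →
              (∀ v y → R v y ≡ true ⇔ v ≡ f y) → ∀ ys →
              ΣV V (λ v → length (filterᵇ (R v) ys)) ≡ length (filterᵇ (V ∘ f) ys)
fibre-count V f R graph [] = ΣV-0 V
fibre-count V f R graph (y ∷ ys) = begin
  ΣV V (λ v → length (filterᵇ (R v) (y ∷ ys)))
    ≡⟨ ΣV-cong V (λ v → length-filterᵇ-∷ (R v) y ys) ⟩
  ΣV V (λ v → ι (R v y) + length (filterᵇ (R v) ys))
    ≡⟨ ΣV-+ V (λ v → ι (R v y)) (λ v → length (filterᵇ (R v) ys)) ⟩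
  ΣV V (λ v → ι (R v y)) + ΣV V (λ v → length (filterᵇ (R v) ys))
    ≡⟨ cong₂ _+_ hit-once (fibre-count V f R graph ys) ⟩
  ι (V (f y)) + length (filterᵇ (V ∘ f) ys)
    ≡⟨ sym (length-filterᵇ-∷ (V ∘ f) y ys) ⟩
  length (filterᵇ (V ∘ f) (y ∷ ys)) ∎
  where
  hit-once : ΣV V (λ v → ι (R v y)) ≡ ι (V (f y))
  hit-once = trans (ΣV-point V (λ v → R v y) (f y) (λ v → to (graph v y)))
                   (cong ι (trans (cong (V (f y) ∧_) (from (graph (f y) y) refl)) (∧-identityʳ _)))

implies-true : ∀ {a b} → not a ∨ b ≡ true ⇔ (a ≡ true → b ≡ true)
implies-true {true} = mk⇔ (λ b _ → b) (λ h → h refl)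
implies-true {false} = mk⇔ (λ _ ()) (λ _ → refl)

descᵇ-spec : ∀ {k} (v u : Word k) → descᵇ v u ≡ true ⇔ v ≺ u
descᵇ-spec v u = mk⇔ (λ h i → to implies-true (all-true⇒ _ h (∈-allFin i)))
                     (λ h → all-true⇐ _ {allFin _} (λ {i} _ → from implies-true (h i)))

≺-antisym : ∀ {k} {u v : Word k} → u ≺ v → v ≺ u → u ≡ v
≺-antisym {u = u} {v} u≺v v≺u = begin
  u                   ≡⟨ sym (tabulate∘lookup u) ⟩
  tabulate (lookup u) ≡⟨ tabulate-cong (λ i → ⇔→≡ (mk⇔ (u≺v i) (v≺u i))) ⟩
  tabulate (lookup v) ≡⟨ tabulate∘lookup v ⟩
  v                   ∎

properDescᵇ-spec : ∀ {k} (v' v : Word k) →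
                   descᵇ v' v ∧ not ⌊ ≡-dec _≟ᵇ_ v' v ⌋ ≡ true ⇔ (v' ≺ v × v' ≢ v)
properDescᵇ-spec v' v with descᵇ v' v in desc | ≡-dec _≟ᵇ_ v' v
... | true | yes v'≡v = mk⇔ (λ ()) (λ (_ , v'≢v) → ⊥-elim (v'≢v v'≡v))
... | true | no v'≢v = mk⇔ (λ _ → to (descᵇ-spec v' v) desc , v'≢v) (λ _ → refl)
... | false | _ = mk⇔ (λ ()) (λ (v'≺v , _) → trans (sym desc) (from (descᵇ-spec v' v) v'≺v))

edge-clause-true : ∀ {e a b} → not (e ∧ not a) ∨ not b ≡ true ⇔ (e ≡ true → b ≡ true → a ≡ true)
edge-clause-true {false} = mk⇔ (λ _ ()) (λ _ → refl)
edge-clause-true {true} {true} = mk⇔ (λ _ _ _ → refl) (λ _ → refl)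
edge-clause-true {true} {false} {true} = mk⇔ (λ ()) (λ h → h refl refl)
edge-clause-true {true} {false} {false} = mk⇔ (λ _ _ ()) (λ _ → refl)

nand-true : ∀ {a b} → not (a ∧ b) ≡ true ⇔ (¬ (a ≡ true × b ≡ true))
nand-true {true} {true} = mk⇔ (λ ()) (λ both → ⊥-elim (both (refl , refl)))
nand-true {true} {false} = mk⇔ (λ _ → λ { (_ , ()) }) (λ _ → refl)
nand-true {false} = mk⇔ (λ _ → λ { (() , _) }) (λ _ → refl)

module _ {m n : ℕ} (E : Edges m n) where

  -- The least word compatible with y: i is marked iff some edge (i,j) has y_j = 1.
  μ : Word n → Word m
  μ y = tabulate (λ i → any (λ j → E i j ∧ lookup y j) (allFin n))

  μ-spec : ∀ y i → lookup (μ y) i ≡ true ⇔ (∃ λ j → E i j ≡ true × lookup y j ≡ true)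
  μ-spec y i = mk⇔
    (λ μi → let j , _ , Eij∧yj = any-true⇒ edge-to-1 (allFin n) (trans (sym (lookup∘tabulate _ i)) μi)
            in j , to ∧-true Eij∧yj)
    (λ (j , Eij , yj) → trans (lookup∘tabulate _ i)
                              (any-true⇐ edge-to-1 (∈-allFin j) (from ∧-true (Eij , yj))))
    where
    edge-to-1 : Fin n → Bool
    edge-to-1 j = E i j ∧ lookup y j

  compat-spec : ∀ x y → compat E x y ≡ true ⇔
                (∀ i j → E i j ≡ true → lookup y j ≡ true → lookup x i ≡ true)
  compat-spec x y = mk⇔
    (λ c i j → to edge-clause-true (all-true⇒ _ (all-true⇒ _ c (∈-allFin i)) (∈-allFin j)))
    (λ h → all-true⇐ _ {allFin m} λ {i} _ → all-true⇐ _ {allFin n} λ {j} _ → from edge-clause-true (h i j))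

  compat⇔μ≺ : ∀ x y → compat E x y ≡ true ⇔ μ y ≺ x
  compat⇔μ≺ x y = mk⇔
    (λ c i μi → let j , Eij , yj = to (μ-spec y i) μi in to (compat-spec x y) c i j Eij yj)
    (λ μ≺x → from (compat-spec x y) (λ i j Eij yj → μ≺x i (from (μ-spec y i) (j , Eij , yj))))

  compat-μ : ∀ y → compat E (μ y) y ≡ true
  compat-μ y = from (compat⇔μ≺ (μ y) y) (λ _ μi → μi)

  N-member : (V : Subset m) → DClosed V → ∀ y →
             any (λ x → V x ∧ compat E x y) (allWords m) ≡ V (μ y)
  N-member V closed y = ⇔→≡ (mk⇔
    (λ inN → let x , _ , Vx∧c = any-true⇒ (λ x → V x ∧ compat E x y) (allWords m) inN
                 Vx , c = to ∧-true Vx∧c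
             in closed x (μ y) Vx (to (compat⇔μ≺ x y) c))
    (λ Vμ → any-true⇐ _ (∈-allWords (μ y)) (from ∧-true (Vμ , compat-μ y))))

  newAt : Word m → Word n → Bool
  newAt v y = compat E v y ∧ all (λ v' → not (properDescᵇ v' v ∧ compat E v' y)) (allWords m)

  newAt-spec : ∀ v y → newAt v y ≡ true ⇔ v ≡ μ y
  newAt-spec v y = mk⇔ sound complete
    where
    -- otherwise μ y would be a proper descendant of v compatible with y
    sound : newAt v y ≡ true → v ≡ μ y
    sound new with to ∧-true new | ≡-dec _≟ᵇ_ (μ y) v
    ... | _ | yes μ≡v = sym μ≡v
    ... | c , no-proper | no μ≢v =
      ⊥-elim (to nand-true (all-true⇒ _ no-proper (∈-allWords (μ y)))
                (from (properDescᵇ-spec (μ y) v) (to (compat⇔μ≺ v y) c , μ≢v) , compat-μ y))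

    -- a word compatible with y lies above μ y, so it is no proper descendant of μ y
    complete : v ≡ μ y → newAt v y ≡ true
    complete refl = from ∧-true (compat-μ y , all-true⇐ _ {allWords m} (λ {v'} _ → from nand-true
      (λ (proper , c) → let v'≺μ , v'≢μ = to (properDescᵇ-spec v' (μ y)) proper
                         in v'≢μ (≺-antisym v'≺μ (to (compat⇔μ≺ v' y) c)))))

-- Both sides count the y ∈ B(n,w) with μ y ∈ V.
lemma27 : (m n : ℕ) (E : Edges m n) → IsDominationGraph E → (w : ℕ) →
          (V : Subset m) → DClosed V → |N| E w V ≡ ΨSet E w V
lemma27 m n E _ w V closed = begin
  |N| E w V
    ≡⟨ cong length (filterᵇ-cong (N-member E V closed) (B n w)) ⟩
  length (filterᵇ (V ∘ μ E) (B n w))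
    ≡⟨ sym (fibre-count V (μ E) (newAt E) (newAt-spec E) (B n w)) ⟩
  ΨSet E w V ∎
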